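{- Let $M_k(z)=\sum_{n\ge0}M_{k,n}z^{n+1}$ and $C_k(z)=\sum_{n\ge0}C_{k,n}z^{n+1}$. For $k\ge0$, \[ M_k(z)=z+zM_k(z)+zM_k(z)^2+\cdots+zM_k(z)^k. \] For $k\ge1$, \[ C_k(z)=z+zM_{k-1}(z)+zM_{k-1}(z)^2+\cdots=\frac{z}{1-M_{k-1}(z)} \] and \[ (C_k(z)-z)^k-C_k(z)^k+C_k(z)^{k-1}-zC_k(z)^{k-2}=0. \]
   Context: A plane tree is a rooted tree whose children at each node are linearly ordered; the degree of a node is its number of children. For $k\ge0$, $M_{k,n}$ is the number of plane trees with $n+1$ nodes in which every node has degree at most $k$. For $k\ge1$, $C_{k,n}$ is the modular Catalan number: the number of classes of binary trees with $n+1$ leaves under the equivalence generated by $k$-rotations, where a binary tree has every node with $0$ or $2$ ordered children, $s\wedge t$ is the tree with left subtree $s$ and right subtree $t$ (iterated $\wedge$ read left to right), and a $k$-rotation replaces a maximal subtree $(t_0\wedge\cdots\wedge t_k)\wedge t_{k+1}$ by $t_0\wedge(t_1\wedge\cdots\wedge t_{k+1})$ or vice versa. (Equivalently, $C_{k,n}$ is the number of plane trees with $n+1$ nodes whose non-root nodes all have degree less than $k$.) -}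

module Defs where

open import Data.Nat using (ℕ; zero; suc; _∸_; _≤_)
open import Data.Integer using (ℤ; +_; _+_; _-_; _*_)
open import Data.List using (List; []; _∷_; length; _++_)
open import Data.List.Relation.Unary.All using (All)
open import Data.List.Relation.Unary.Any using (Any)
open import Data.List.Relation.Unary.AllPairs using (AllPairs)
open import Data.List.Relation.Unary.Unique.Propositional using (Unique)
open import Data.List.Membership.Propositional using (_∈_)
open import Data.Product using (Σ; _×_)
open import Function.Bundles using (_⇔_)
open import Relation.Binary.PropositionalEquality using (_≡_)
open import Relation.Binary.Construct.Closure.Equivalence using (EqClosure)
open import Relation.Nullary using (¬_)

Count : {A : Set} → (A → Set) → ℕ → Set
Count {A} P c = Σ (List A) λ xs → (length xs ≡ c) × Unique xs × (∀ x → (x ∈ xs) ⇔ P x)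

ClassCount : {A : Set} → (A → A → Set) → (A → Set) → ℕ → Set
ClassCount {A} R P c =
  Σ (List A) λ reps → (length reps ≡ c) × All P reps
    × AllPairs (λ a b → ¬ R a b) reps × (∀ x → P x → Any (R x) reps)

data PTree : Set where
  node : List PTree → PTree

mutual
  nodes : PTree → ℕ
  nodes (node ts) = suc (nodesL ts)

  nodesL : List PTree → ℕ
  nodesL [] = 0
  nodesL (t ∷ ts) = nodes t Data.Nat.+ nodesL ts

data DegLe (k : ℕ) : PTree → Set where
  node : ∀ {ts} → length ts ≤ k → All (DegLe k) ts → DegLe k (node ts)

-- plane trees with n+1 nodes, all of degree ≤ k (counted by M_{k,n})
PlaneBounded : ℕ → ℕ → PTree → Set
PlaneBounded k n t = (nodes t ≡ suc n) × DegLe k t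

infixl 6 _∧_
data BTree : Set where
  leaf : BTree
  _∧_  : BTree → BTree → BTree

leaves : BTree → ℕ
leaves leaf = 1
leaves (s ∧ t) = leaves s Data.Nat.+ leaves t

iter : BTree → List BTree → BTree
iter t [] = t
iter t (s ∷ ss) = iter (t ∧ s) ss

data Rot (k : ℕ) : BTree → BTree → Set where
  here  : ∀ t₀ t₁ rest u → length (t₁ ∷ rest) ≡ k →
          Rot k (iter t₀ (t₁ ∷ rest) ∧ u) (t₀ ∧ iter t₁ (rest ++ u ∷ []))
  left  : ∀ {s s'} t → Rot k s s' → Rot k (s ∧ t) (s' ∧ t)
  right : ∀ {t t'} s → Rot k t t' → Rot k (s ∧ t) (s ∧ t')

RotEq : ℕ → BTree → BTree → Set
RotEq k = EqClosure (Rot k)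

BinLeaves : ℕ → BTree → Set
BinLeaves n t = leaves t ≡ suc n

Series : Set
Series = ℕ → ℤ

_≋_ : Series → Series → Set
f ≋ g = ∀ n → f n ≡ g n

infixl 6 _⊕_ _⊖_
infixl 7 _⊛_
infixr 8 _^^_
infix 4 _≋_

_⊕_ : Series → Series → Series
(f ⊕ g) n = f n + g n

_⊖_ : Series → Series → Series
(f ⊖ g) n = f n - g n

sumTo : ℕ → (ℕ → ℤ) → ℤ
sumTo zero a = a 0
sumTo (suc n) a = sumTo n a + a (suc n)

_⊛_ : Series → Series → Series
(f ⊛ g) n = sumTo n (λ i → f i * g (n ∸ i))

zeroS : Series
zeroS _ = + 0

oneS : Series
oneS zero = + 1
oneS (suc _) = + 0

zS : Series
zS 1 = + 1
zS _ = + 0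

_^^_ : Series → ℕ → Series
f ^^ zero = oneS
f ^^ suc m = f ⊛ f ^^ m

sumS : ℕ → (ℕ → Series) → Series
sumS zero f = zeroS
sumS (suc m) f = sumS m f ⊕ f m

-- infinite sum Σ_{j≥0} f j, for families where f j has no terms below z^{j+1}
-- (so the coefficient of z^n only involves j ≤ n)
infSum : (ℕ → Series) → Series
infSum f n = sumTo n (λ j → f j n)

gen : (ℕ → ℕ) → Series
gen a zero = + 0
gen a (suc n) = + a n

module Submission where

-- A plane tree is a root together with a forest of subtrees, and the forests of d trees are
-- counted by the coefficients of M^d. Hence M = z(1 + M + ⋯ + M^k), and multiplying by 1 − M
-- gives z(1 − M^{k+1}) = M(1 − M).
--
-- For the modular Catalan numbers we read a binary tree as a plane forest whose nodes all have
-- degree < k. This forest is invariant under k-rotations, and conversely every binary tree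
-- rotates to the left comb rebuilt from its forest. So the classes with n+1 leaves correspond
-- to the forests with n nodes of degree ≤ k−1, i.e. C = z F with F = 1 + M_{k−1} F, which is
-- C(1 − M_{k−1}) = z. Writing X = C and M = M_{k−1}, this gives X − z = XM, so the left-hand
-- side of the algebraic equation factors as X^{k−2} D with D = X²M^k − X² + X − z, and z D is
-- a combination of X(1 − M) = z and z(1 − M^k) = M(1 − M); since z is not a zero divisor, D = 0.

open import Defs
open import Level using (0ℓ)
open import Function using (_∘_)
open import Function.Bundles using (_⇔_; mk⇔; Equivalence)
open import Relation.Nullary using (¬_; yes; no)
open import Relation.Binary.PropositionalEquality hiding ([_])
import Relation.Binary.Reasoning.Setoid
open import Relation.Binary.Construct.Closure.Equivalence using (gmap; gfold; return; symmetric)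
import Relation.Binary.Construct.Closure.Equivalence as EqClosure
open import Algebra.Bundles using (CommutativeRing)
open import Algebra.Solver.Ring.AlmostCommutativeRing using (fromCommutativeRing; _-Raw-AlmostCommutative⟶_)

open import Data.Empty using (⊥; ⊥-elim)
open import Data.Maybe using (Maybe; just; nothing)
open import Data.Product using (∃; _×_; _,_)
open import Data.Sum using (_⊎_; inj₁; inj₂)
open import Data.Nat using (ℕ; zero; suc; _∸_; _≤_; z≤n; s≤s)
import Data.Nat as ℕ
import Data.Nat.Properties as ℕ
open import Data.Nat.DivMod using (_%_; _/_; m≡m%n+[m/n]*n; [m+kn]%n≡m%n; m%n<n; m%n≤m; m<n⇒m%n≡m)
open import Data.Nat.Divisibility using (_∣_; divides)
import Data.Nat.Tactic.RingSolver as ℕ-Solver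
open import Data.Integer using (ℤ; +_; -_; _+_; _*_; _≟_; +-*-rawRing)
import Data.Integer.Properties as ℤ
open import Data.Integer.Tactic.RingSolver using (solve-∀)

open import Data.List using (List; []; _∷_; [_]; length; _++_; map; take; drop; cartesianProductWith; initLast; _∷ʳ′_)
import Data.List.Properties as List
open import Data.List.Relation.Unary.All using (All; []; _∷_)
import Data.List.Relation.Unary.All as All
import Data.List.Relation.Unary.All.Properties as All
open import Data.List.Relation.Unary.AllPairs using ([]; _∷_)
import Data.List.Relation.Unary.AllPairs as AllPairs
import Data.List.Relation.Unary.AllPairs.Properties as AllPairs
open import Data.List.Relation.Unary.Any using (here)
import Data.List.Relation.Unary.Any as Any
import Data.List.Relation.Unary.Any.Properties as Any
import Data.List.Relation.Unary.Unique.Propositional.Properties as Unique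
open import Data.List.Membership.Propositional using (_∈_)
open import Data.List.Membership.Propositional.Properties
  using (∈-++⁺ˡ; ∈-++⁺ʳ; ∈-++⁻; ∈-map⁺; ∈-map⁻; ∈-cartesianProductWith⁺; ∈-cartesianProductWith⁻)
open import Data.List.Membership.Propositional.Properties.WithK using (unique∧set⇒bag)
open import Data.List.Relation.Binary.BagAndSetEquality using (∼bag⇒↭)
open import Data.List.Relation.Binary.Permutation.Propositional.Properties using (↭-length)

sumTo-cong : ∀ n {a b : ℕ → ℤ} → (∀ {i} → i ≤ n → a i ≡ b i) → sumTo n a ≡ sumTo n b
sumTo-cong zero    a≡b = a≡b z≤n
sumTo-cong (suc n) a≡b = cong₂ _+_ (sumTo-cong n (a≡b ∘ ℕ.m≤n⇒m≤1+n)) (a≡b ℕ.≤-refl)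

sumTo-ext : ∀ n {a b : ℕ → ℤ} → (∀ i → a i ≡ b i) → sumTo n a ≡ sumTo n b
sumTo-ext n a≡b = sumTo-cong n (λ {i} _ → a≡b i)

sumTo-suc-head : ∀ n (a : ℕ → ℤ) → sumTo (suc n) a ≡ a 0 + sumTo n (a ∘ suc)
sumTo-suc-head zero    a = refl
sumTo-suc-head (suc n) a = begin
  sumTo (suc n) a + a (2 ℕ.+ n)                  ≡⟨ cong (_+ a (2 ℕ.+ n)) (sumTo-suc-head n a) ⟩
  a 0 + sumTo n (a ∘ suc) + a (2 ℕ.+ n)          ≡⟨ ℤ.+-assoc (a 0) _ _ ⟩
  a 0 + sumTo (suc n) (a ∘ suc)                  ∎
  where open ≡-Reasoning

sumTo-+ : ∀ n (a b : ℕ → ℤ) → sumTo n (λ i → a i + b i) ≡ sumTo n a + sumTo n b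
sumTo-+ zero    a b = refl
sumTo-+ (suc n) a b = trans (cong (_+ (a (suc n) + b (suc n))) (sumTo-+ n a b))
                            (+-interchange (sumTo n a) (sumTo n b) (a (suc n)) (b (suc n)))
  where
  +-interchange : ∀ w x y z → (w + x) + (y + z) ≡ (w + y) + (x + z)
  +-interchange = solve-∀

sumTo-*ˡ : ∀ n c (a : ℕ → ℤ) → c * sumTo n a ≡ sumTo n (λ i → c * a i)
sumTo-*ˡ zero    c a = refl
sumTo-*ˡ (suc n) c a = trans (ℤ.*-distribˡ-+ c (sumTo n a) (a (suc n)))
                             (cong (_+ c * a (suc n)) (sumTo-*ˡ n c a))

sumTo-zero : ∀ n → sumTo n (λ _ → + 0) ≡ + 0
sumTo-zero zero    = refl
sumTo-zero (suc n) = cong (_+ + 0) (sumTo-zero n)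

sumTo-reverse : ∀ n (a : ℕ → ℤ) → sumTo n a ≡ sumTo n (λ i → a (n ∸ i))
sumTo-reverse zero    a = refl
sumTo-reverse (suc n) a = begin
  sumTo n a + a (suc n)                           ≡⟨ cong (_+ a (suc n)) (sumTo-reverse n a) ⟩
  sumTo n (λ i → a (n ∸ i)) + a (suc n)           ≡⟨ ℤ.+-comm _ (a (suc n)) ⟩
  a (suc n) + sumTo n (λ i → a (n ∸ i))           ≡⟨ sumTo-suc-head n (λ i → a (suc n ∸ i)) ⟨
  sumTo (suc n) (λ i → a (suc n ∸ i))             ∎
  where open ≡-Reasoning

shift : Series → Series
shift f n = f (suc n)

scale : ℤ → Series → Series
scale c f n = c * f n

negS : Series → Series
negS f n = - f n

⊛-congˡ : ∀ {f f′} g → f ≋ f′ → f ⊛ g ≋ f′ ⊛ g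
⊛-congˡ g f≋f′ n = sumTo-ext n (λ i → cong (_* g (n ∸ i)) (f≋f′ i))

⊛-congʳ : ∀ f {g g′} → g ≋ g′ → f ⊛ g ≋ f ⊛ g′
⊛-congʳ f g≋g′ n = sumTo-ext n (λ i → cong (f i *_) (g≋g′ (n ∸ i)))

⊕-cong : ∀ {f f′ g g′} → f ≋ f′ → g ≋ g′ → f ⊕ g ≋ f′ ⊕ g′
⊕-cong f≋f′ g≋g′ n = cong₂ _+_ (f≋f′ n) (g≋g′ n)

⊛-cong : ∀ {f f′ g g′} → f ≋ f′ → g ≋ g′ → f ⊛ g ≋ f′ ⊛ g′
⊛-cong {f′ = f′} {g} f≋f′ g≋g′ n = trans (⊛-congˡ g f≋f′ n) (⊛-congʳ f′ g≋g′ n)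

⊛-suc : ∀ f g n → (f ⊛ g) (suc n) ≡ f 0 * g (suc n) + (shift f ⊛ g) n
⊛-suc f g n = sumTo-suc-head n (λ i → f i * g (suc n ∸ i))

⊛-comm : ∀ f g → f ⊛ g ≋ g ⊛ f
⊛-comm f g n = trans (sumTo-reverse n _) (sumTo-cong n swap)
  where
  swap : ∀ {i} → i ≤ n → f (n ∸ i) * g (n ∸ (n ∸ i)) ≡ g i * f (n ∸ i)
  swap {i} i≤n rewrite ℕ.m∸[m∸n]≡n i≤n = ℤ.*-comm (f (n ∸ i)) (g i)

⊛-distribʳ : ∀ f g h → (f ⊕ g) ⊛ h ≋ f ⊛ h ⊕ g ⊛ h
⊛-distribʳ f g h n = trans (sumTo-ext n (λ i → ℤ.*-distribʳ-+ (h (n ∸ i)) (f i) (g i))) (sumTo-+ n _ _)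

⊛-distribˡ : ∀ f g h → f ⊛ (g ⊕ h) ≋ f ⊛ g ⊕ f ⊛ h
⊛-distribˡ f g h n = trans (⊛-comm f (g ⊕ h) n)
  (trans (⊛-distribʳ g h f n) (cong₂ _+_ (⊛-comm g f n) (⊛-comm h f n)))

scale-⊛ : ∀ c f g → scale c f ⊛ g ≋ scale c (f ⊛ g)
scale-⊛ c f g n = trans (sumTo-ext n (λ i → ℤ.*-assoc c (f i) (g (n ∸ i)))) (sym (sumTo-*ˡ n c _))

⊛-zeroˡ : ∀ g → zeroS ⊛ g ≋ zeroS
⊛-zeroˡ g n = trans (sumTo-ext n (λ i → ℤ.*-zeroˡ (g (n ∸ i)))) (sumTo-zero n)

⊛-identityˡ : ∀ g → oneS ⊛ g ≋ g
⊛-identityˡ g zero    = ℤ.*-identityˡ (g 0)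
⊛-identityˡ g (suc n) = begin
  (oneS ⊛ g) (suc n)              ≡⟨ ⊛-suc oneS g n ⟩
  + 1 * g (suc n) + (zeroS ⊛ g) n ≡⟨ cong₂ _+_ (ℤ.*-identityˡ (g (suc n))) (⊛-zeroˡ g n) ⟩
  g (suc n) + + 0                 ≡⟨ ℤ.+-identityʳ _ ⟩
  g (suc n)                       ∎
  where open ≡-Reasoning

⊛-identityʳ : ∀ g → g ⊛ oneS ≋ g
⊛-identityʳ g n = trans (⊛-comm g oneS n) (⊛-identityˡ g n)

shift-⊛ : ∀ f g → shift (f ⊛ g) ≋ scale (f 0) (shift g) ⊕ shift f ⊛ g
shift-⊛ f g = ⊛-suc f g

⊛-assoc : ∀ f g h → (f ⊛ g) ⊛ h ≋ f ⊛ (g ⊛ h)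
⊛-assoc f g h zero    = ℤ.*-assoc (f 0) (g 0) (h 0)
⊛-assoc f g h (suc n) = begin
  ((f ⊛ g) ⊛ h) (suc n)
    ≡⟨ ⊛-suc (f ⊛ g) h n ⟩
  f 0 * g 0 * h (suc n) + (shift (f ⊛ g) ⊛ h) n
    ≡⟨ cong (λ x → f 0 * g 0 * h (suc n) + x)
            (trans (⊛-congˡ h (shift-⊛ f g) n) (⊛-distribʳ (scale (f 0) (shift g)) (shift f ⊛ g) h n)) ⟩
  f 0 * g 0 * h (suc n) + ((scale (f 0) (shift g) ⊛ h) n + ((shift f ⊛ g) ⊛ h) n)
    ≡⟨ cong₂ (λ x y → f 0 * g 0 * h (suc n) + (x + y)) (scale-⊛ (f 0) (shift g) h n) (⊛-assoc (shift f) g h n) ⟩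
  f 0 * g 0 * h (suc n) + (f 0 * (shift g ⊛ h) n + (shift f ⊛ (g ⊛ h)) n)
    ≡⟨ regroup (f 0) (g 0) (h (suc n)) ((shift g ⊛ h) n) ((shift f ⊛ (g ⊛ h)) n) ⟩
  f 0 * (g 0 * h (suc n) + (shift g ⊛ h) n) + (shift f ⊛ (g ⊛ h)) n
    ≡⟨ cong (λ x → f 0 * x + (shift f ⊛ (g ⊛ h)) n) (⊛-suc g h n) ⟨
  f 0 * (g ⊛ h) (suc n) + (shift f ⊛ (g ⊛ h)) n
    ≡⟨ ⊛-suc f (g ⊛ h) n ⟨
  (f ⊛ (g ⊛ h)) (suc n) ∎
  where
  open ≡-Reasoning
  regroup : ∀ a b c d e → a * b * c + (a * d + e) ≡ a * (b * c + d) + e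
  regroup = solve-∀

seriesRing : CommutativeRing 0ℓ 0ℓ
seriesRing = record
  { Carrier = Series ; _≈_ = _≋_ ; _+_ = _⊕_ ; _*_ = _⊛_ ; -_ = negS ; 0# = zeroS ; 1# = oneS
  ; isCommutativeRing = record
    { isRing = record
      { +-isAbelianGroup = record
        { isGroup = record
          { isMonoid = record
            { isSemigroup = record
              { isMagma = record
                { isEquivalence = record { refl = λ _ → refl ; sym = λ e n → sym (e n) ; trans = λ e e′ n → trans (e n) (e′ n) }
                ; ∙-cong = λ e e′ n → cong₂ _+_ (e n) (e′ n) }
              ; assoc = λ f g h n → ℤ.+-assoc (f n) (g n) (h n) }
            ; identity = (λ f n → ℤ.+-identityˡ (f n)) , (λ f n → ℤ.+-identityʳ (f n)) }
          ; inverse = (λ f n → ℤ.+-inverseˡ (f n)) , (λ f n → ℤ.+-inverseʳ (f n))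
          ; ⁻¹-cong = λ e n → cong -_ (e n) }
        ; comm = λ f g n → ℤ.+-comm (f n) (g n) }
      ; *-cong = ⊛-cong
      ; *-assoc = ⊛-assoc
      ; *-identity = ⊛-identityˡ , ⊛-identityʳ
      ; distrib = ⊛-distribˡ , (λ h f g → ⊛-distribʳ f g h) }
    ; *-comm = ⊛-comm } }

module ≋-Reasoning = Relation.Binary.Reasoning.Setoid (CommutativeRing.setoid seriesRing)
open CommutativeRing seriesRing using () renaming (refl to ≋-refl; sym to ≋-sym; trans to ≋-trans; zeroʳ to ⊛-zeroʳ)

constS : ℤ → Series
constS c = scale c oneS

constS-homomorphism : +-*-rawRing -Raw-AlmostCommutative⟶ fromCommutativeRing seriesRing
constS-homomorphism = record
  { ⟦_⟧    = constS
  ; +-homo = λ a b n → ℤ.*-distribʳ-+ (oneS n) a b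
  ; *-homo = λ a b n → sym (trans (scale-⊛ a oneS (constS b) n)
                            (trans (cong (a *_) (⊛-identityˡ (constS b) n)) (sym (ℤ.*-assoc a b (oneS n)))))
  ; -‿homo = λ a n → sym (ℤ.neg-distribˡ-* a (oneS n))
  ; 0-homo = λ n → ℤ.*-zeroˡ (oneS n)
  ; 1-homo = λ n → ℤ.*-identityˡ (oneS n) }

constS-≟ : ∀ a b → Maybe (constS a ≋ constS b)
constS-≟ a b with a ≟ b
... | yes refl = just (λ _ → refl)
... | no  _    = nothing

open import Algebra.Solver.Ring +-*-rawRing (fromCommutativeRing seriesRing) constS-homomorphism constS-≟
  using (solve; _:+_; _:-_; _:*_; :-_; _:=_)

shift-zS : shift zS ≋ oneS
shift-zS zero    = refl
shift-zS (suc n) = refl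

zS⊛-suc : ∀ f n → (zS ⊛ f) (suc n) ≡ f n
zS⊛-suc f n = begin
  (zS ⊛ f) (suc n)                   ≡⟨ ⊛-suc zS f n ⟩
  + 0 * f (suc n) + (shift zS ⊛ f) n ≡⟨ cong (λ x → + 0 * f (suc n) + x) (trans (⊛-congˡ f shift-zS n) (⊛-identityˡ f n)) ⟩
  + 0 * f (suc n) + f n              ≡⟨ ℤ.+-identityˡ (f n) ⟩
  f n                                ∎
  where open ≡-Reasoning

zS⊛-cancel : ∀ {f} → zS ⊛ f ≋ zeroS → f ≋ zeroS
zS⊛-cancel {f} zf≋0 n = trans (sym (zS⊛-suc f n)) (zf≋0 (suc n))

≋⇒⊖≋zeroS : ∀ {f g} → f ≋ g → f ⊖ g ≋ zeroS
≋⇒⊖≋zeroS {f} {g} f≋g n = trans (cong (λ x → x + - g n) (f≋g n)) (ℤ.+-inverseʳ (g n))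

oneS⊖-⊛ : ∀ f g → (oneS ⊖ f) ⊛ g ≋ g ⊖ f ⊛ g
oneS⊖-⊛ f g = ≋-trans (distrib oneS f g) (⊕-cong (⊛-identityˡ g) (≋-refl {negS (f ⊛ g)}))
  where
  distrib : ∀ o f g → (o ⊖ f) ⊛ g ≋ o ⊛ g ⊖ f ⊛ g
  distrib = solve 3 (λ o f g → (o :- f) :* g := o :* g :- f :* g) (λ _ → refl)

⊛-oneS⊖ : ∀ f g → f ⊛ (oneS ⊖ g) ≋ f ⊖ f ⊛ g
⊛-oneS⊖ f g = ≋-trans (⊛-comm f (oneS ⊖ g)) (≋-trans (oneS⊖-⊛ g f) (⊕-cong (≋-refl {f}) (λ n → cong -_ (⊛-comm g f n))))

⊛-sumS : ∀ m f g → f ⊛ sumS m g ≋ sumS m (λ i → f ⊛ g i)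
⊛-sumS zero    f g = ⊛-zeroʳ f
⊛-sumS (suc m) f g = ≋-trans (⊛-distribˡ f (sumS m g) (g m)) (⊕-cong (⊛-sumS m f g) (≋-refl {f ⊛ g m}))

sumS-suc-head : ∀ m g → sumS (suc m) g ≋ g 0 ⊕ sumS m (g ∘ suc)
sumS-suc-head zero    g n = trans (ℤ.+-identityˡ (g 0 n)) (sym (ℤ.+-identityʳ (g 0 n)))
sumS-suc-head (suc m) g n = trans (cong (_+ g (suc m) n) (sumS-suc-head m g n)) (ℤ.+-assoc (g 0 n) (sumS m (g ∘ suc) n) (g (suc m) n))

sumS-suc-apply : ∀ m g n → sumS (suc m) g n ≡ sumTo m (λ i → g i n)
sumS-suc-apply zero    g n = ℤ.+-identityˡ (g 0 n)
sumS-suc-apply (suc m) g n = cong (_+ g (suc m) n) (sumS-suc-apply m g n)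

geometric-sum : ∀ m f → (oneS ⊖ f) ⊛ sumS m (f ^^_) ≋ oneS ⊖ f ^^ m
geometric-sum zero    f = ≋-trans (⊛-zeroʳ (oneS ⊖ f)) (≋-sym (≋⇒⊖≋zeroS (≋-refl {oneS})))
geometric-sum (suc m) f = begin
  (oneS ⊖ f) ⊛ (sumS m (f ^^_) ⊕ f ^^ m)                 ≈⟨ ⊛-distribˡ (oneS ⊖ f) (sumS m (f ^^_)) (f ^^ m) ⟩
  (oneS ⊖ f) ⊛ sumS m (f ^^_) ⊕ (oneS ⊖ f) ⊛ f ^^ m       ≈⟨ ⊕-cong (geometric-sum m f) (oneS⊖-⊛ f (f ^^ m)) ⟩
  (oneS ⊖ f ^^ m) ⊕ (f ^^ m ⊖ f ^^ suc m)                 ≈⟨ telescope oneS (f ^^ m) (f ^^ suc m) ⟩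
  oneS ⊖ f ^^ suc m                                       ∎
  where
  open ≋-Reasoning
  telescope : ∀ f g h → (f ⊖ g) ⊕ (g ⊖ h) ≋ f ⊖ h
  telescope f g h n = ℤ-telescope (f n) (g n) (h n)
    where
    ℤ-telescope : ∀ a b c → (a + - b) + (b + - c) ≡ a + - c
    ℤ-telescope = solve-∀

^^-cong : ∀ m {f g} → f ≋ g → f ^^ m ≋ g ^^ m
^^-cong zero    f≋g = ≋-refl
^^-cong (suc m) f≋g = ⊛-cong f≋g (^^-cong m f≋g)

^^-distrib-⊛ : ∀ f g m → (f ⊛ g) ^^ m ≋ f ^^ m ⊛ g ^^ m
^^-distrib-⊛ f g zero    = ≋-sym (⊛-identityˡ oneS)
^^-distrib-⊛ f g (suc m) = ≋-trans (⊛-congʳ (f ⊛ g) (^^-distrib-⊛ f g m)) (interchange f g (f ^^ m) (g ^^ m))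
  where
  interchange : ∀ a b c d → (a ⊛ b) ⊛ (c ⊛ d) ≋ (a ⊛ c) ⊛ (b ⊛ d)
  interchange = solve 4 (λ a b c d → (a :* b) :* (c :* d) := (a :* c) :* (b :* d)) (λ _ → refl)

algebraic-equation : ∀ m {X M Z : Series} →
  X ⊖ X ⊛ M ≋ Z →
  Z ⊖ Z ⊛ M ^^ (2 ℕ.+ m) ≋ M ⊖ M ⊛ M →
  (∀ {f} → Z ⊛ f ≋ zeroS → f ≋ zeroS) →
  (X ⊖ Z) ^^ (2 ℕ.+ m) ⊖ X ^^ (2 ℕ.+ m) ⊕ X ^^ (1 ℕ.+ m) ⊖ Z ⊛ X ^^ m ≋ zeroS
algebraic-equation m {X} {M} {Z} X-XM≋Z Z-ZMᵏ≋M-MM Z-cancel = begin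
  (X ⊖ Z) ^^ k ⊖ X ^^ k ⊕ X ^^ (1 ℕ.+ m) ⊖ Z ⊛ P
    ≈⟨ ⊕-cong (⊕-cong (⊕-cong [X-Z]ᵏ≋Xᵏ⊛Mᵏ ≋-refl) ≋-refl) ≋-refl ⟩
  X ^^ k ⊛ M ^^ k ⊖ X ^^ k ⊕ X ^^ (1 ℕ.+ m) ⊖ Z ⊛ P
    ≈⟨ factor X P (M ^^ k) Z ⟩
  P ⊛ D
    ≈⟨ ⊛-congʳ P (Z-cancel {D} Z⊛D≋0) ⟩
  P ⊛ zeroS
    ≈⟨ ⊛-zeroʳ P ⟩
  zeroS ∎
  where
  open ≋-Reasoning
  k = 2 ℕ.+ m
  P = X ^^ m
  D = X ⊛ X ⊛ M ^^ k ⊖ X ⊛ X ⊕ X ⊖ Z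

  [X-Z]ᵏ≋Xᵏ⊛Mᵏ : (X ⊖ Z) ^^ k ≋ X ^^ k ⊛ M ^^ k
  [X-Z]ᵏ≋Xᵏ⊛Mᵏ = ≋-trans (^^-cong k X-Z≋XM) (^^-distrib-⊛ X M k)
    where
    X-Z≋XM : X ⊖ Z ≋ X ⊛ M
    X-Z≋XM n = trans (cong (λ z → X n + - z) (sym (X-XM≋Z n))) (cancel (X n) ((X ⊛ M) n))
      where
      cancel : ∀ a b → a + - (a + - b) ≡ b
      cancel = solve-∀

  factor : ∀ X P Q Z → X ⊛ (X ⊛ P) ⊛ Q ⊖ X ⊛ (X ⊛ P) ⊕ X ⊛ P ⊖ Z ⊛ P ≋ P ⊛ (X ⊛ X ⊛ Q ⊖ X ⊛ X ⊕ X ⊖ Z)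
  factor = solve 4 (λ X P Q Z → X :* (X :* P) :* Q :- X :* (X :* P) :+ X :* P :- Z :* P
                              := P :* (X :* X :* Q :- X :* X :+ X :- Z)) (λ _ → refl)

  combination : ∀ X M Z Q → Z ⊛ (X ⊛ X ⊛ Q ⊖ X ⊛ X ⊕ X ⊖ Z)
    ≋ negS (X ⊛ X) ⊛ ((Z ⊖ Z ⊛ Q) ⊖ (M ⊖ M ⊛ M)) ⊕ (Z ⊖ X ⊛ M) ⊛ ((X ⊖ X ⊛ M) ⊖ Z)
  combination = solve 4 (λ X M Z Q → Z :* (X :* X :* Q :- X :* X :+ X :- Z)
    := (:- (X :* X)) :* ((Z :- Z :* Q) :- (M :- M :* M)) :+ (Z :- X :* M) :* ((X :- X :* M) :- Z)) (λ _ → refl)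

  Z⊛D≋0 : Z ⊛ D ≋ zeroS
  Z⊛D≋0 = begin
    Z ⊛ D
      ≈⟨ combination X M Z (M ^^ k) ⟩
    negS (X ⊛ X) ⊛ ((Z ⊖ Z ⊛ M ^^ k) ⊖ (M ⊖ M ⊛ M)) ⊕ (Z ⊖ X ⊛ M) ⊛ ((X ⊖ X ⊛ M) ⊖ Z)
      ≈⟨ ⊕-cong (⊛-congʳ (negS (X ⊛ X)) (≋⇒⊖≋zeroS Z-ZMᵏ≋M-MM)) (⊛-congʳ (Z ⊖ X ⊛ M) (≋⇒⊖≋zeroS X-XM≋Z)) ⟩
    negS (X ⊛ X) ⊛ zeroS ⊕ (Z ⊖ X ⊛ M) ⊛ zeroS
      ≈⟨ ⊕-cong (⊛-zeroʳ (negS (X ⊛ X))) (⊛-zeroʳ (Z ⊖ X ⊛ M)) ⟩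
    zeroS ∎

open Equivalence using (to; from)

count-unique : ∀ {A : Set} {P : A → Set} {a b} → Count P a → Count P b → a ≡ b
count-unique (xs , |xs| , xs! , ∈xs⇔P) (ys , |ys| , ys! , ∈ys⇔P) =
  trans (sym |xs|) (trans (↭-length (∼bag⇒↭ (unique∧set⇒bag xs! ys! same-members))) |ys|)
  where
  same-members : ∀ {x} → x ∈ xs ⇔ x ∈ ys
  same-members {x} = mk⇔ (from (∈ys⇔P x) ∘ to (∈xs⇔P x)) (from (∈xs⇔P x) ∘ to (∈ys⇔P x))

count-resp : ∀ {A : Set} {P Q : A → Set} {a} → (∀ x → P x → Q x) → (∀ x → Q x → P x) → Count P a → Count Q a
count-resp P⇒Q Q⇒P (xs , |xs| , xs! , ∈xs⇔P) =
  xs , |xs| , xs! , λ x → mk⇔ (P⇒Q x ∘ to (∈xs⇔P x)) (from (∈xs⇔P x) ∘ Q⇒P x)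

count-∅ : ∀ {A : Set} {P : A → Set} → (∀ x → ¬ P x) → Count P 0
count-∅ ¬P = [] , refl , [] , λ x → mk⇔ (λ ()) (⊥-elim ∘ ¬P x)

count-singleton : ∀ {A : Set} {P : A → Set} y → P y → (∀ x → P x → x ≡ y) → Count P 1
count-singleton y Py P⇒≡y = y ∷ [] , refl , [] ∷ [] , λ x → mk⇔ (λ { (here refl) → Py }) (here ∘ P⇒≡y x)

count-⊎ : ∀ {A : Set} {P Q : A → Set} {a b} → Count P a → Count Q b → (∀ x → P x → Q x → ⊥) →
          Count (λ x → P x ⊎ Q x) (a ℕ.+ b)
count-⊎ (xs , |xs| , xs! , ∈xs⇔P) (ys , |ys| , ys! , ∈ys⇔Q) disjoint =
  xs ++ ys ,
  trans (List.length-++ xs) (cong₂ ℕ._+_ |xs| |ys|) ,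
  Unique.++⁺ xs! ys! (λ { (x∈xs , x∈ys) → disjoint _ (to (∈xs⇔P _) x∈xs) (to (∈ys⇔Q _) x∈ys) }) ,
  λ x → mk⇔ (Data.Sum.map (to (∈xs⇔P x)) (to (∈ys⇔Q x)) ∘ ∈-++⁻ xs)
            (λ { (inj₁ Px) → ∈-++⁺ˡ (from (∈xs⇔P x) Px) ; (inj₂ Qx) → ∈-++⁺ʳ xs (from (∈ys⇔Q x) Qx) })

count-image : ∀ {A B : Set} {P : A → Set} {a} (f : A → B) → (∀ {x y} → f x ≡ f y → x ≡ y) →
              Count P a → Count (λ y → ∃ λ x → P x × f x ≡ y) a
count-image f f-inj (xs , |xs| , xs! , ∈xs⇔P) =
  map f xs , trans (List.length-map f xs) |xs| , Unique.map⁺ f-inj xs! ,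
  λ y → mk⇔ (λ y∈ → let (x , x∈xs , y≡fx) = ∈-map⁻ f y∈ in x , to (∈xs⇔P x) x∈xs , sym y≡fx)
            (λ { (x , Px , refl) → ∈-map⁺ f (from (∈xs⇔P x) Px) })

length-cartesianProductWith : ∀ {A B C : Set} (f : A → B → C) xs ys →
                              length (cartesianProductWith f xs ys) ≡ length xs ℕ.* length ys
length-cartesianProductWith f []       ys = refl
length-cartesianProductWith f (x ∷ xs) ys = trans (List.length-++ (map (f x) ys))
  (cong₂ ℕ._+_ (List.length-map (f x) ys) (length-cartesianProductWith f xs ys))

count-product : ∀ {A B C : Set} {P : A → Set} {Q : B → Set} {a b} (f : A → B → C) →
                (∀ {w x y z} → f w y ≡ f x z → w ≡ x × y ≡ z) → Count P a → Count Q b →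
                Count (λ c → ∃ λ x → ∃ λ y → P x × Q y × f x y ≡ c) (a ℕ.* b)
count-product f f-inj (xs , |xs| , xs! , ∈xs⇔P) (ys , |ys| , ys! , ∈ys⇔Q) =
  cartesianProductWith f xs ys ,
  trans (length-cartesianProductWith f xs ys) (cong₂ ℕ._*_ |xs| |ys|) ,
  Unique.cartesianProductWith⁺ f f-inj xs! ys! ,
  λ c → mk⇔ (λ c∈ → let (x , y , x∈xs , y∈ys , c≡fxy) = ∈-cartesianProductWith⁻ f xs ys c∈
                    in x , y , to (∈xs⇔P x) x∈xs , to (∈ys⇔Q y) y∈ys , sym c≡fxy)
            (λ { (x , y , Px , Qy , refl) → ∈-cartesianProductWith⁺ f (from (∈xs⇔P x) Px) (from (∈ys⇔Q y) Qy) })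

sumToℕ : ℕ → (ℕ → ℕ) → ℕ
sumToℕ zero    a = a 0
sumToℕ (suc n) a = sumToℕ n a ℕ.+ a (suc n)

+-sumToℕ : ∀ n a → + sumToℕ n a ≡ sumTo n (λ i → + a i)
+-sumToℕ zero    a = refl
+-sumToℕ (suc n) a = trans (ℤ.pos-+ (sumToℕ n a) (a (suc n))) (cong (_+ + a (suc n)) (+-sumToℕ n a))

count-⋃≤ : ∀ {A : Set} (Q : ℕ → A → Set) (c : ℕ → ℕ) n → (∀ {i} → i ≤ n → Count (Q i) (c i)) →
           (∀ {i j x} → Q i x → Q j x → i ≡ j) → Count (λ x → ∃ λ i → i ≤ n × Q i x) (sumToℕ n c)
count-⋃≤ Q c zero    count-Q Q-disjoint =
  count-resp (λ x Qx → 0 , z≤n , Qx) (λ { x (.0 , z≤n , Qx) → Qx }) (count-Q z≤n)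
count-⋃≤ Q c (suc n) count-Q Q-disjoint =
  count-resp split⁻¹ split
    (count-⊎ (count-⋃≤ Q c n (count-Q ∘ ℕ.m≤n⇒m≤1+n) Q-disjoint) (count-Q ℕ.≤-refl)
             (λ { x (i , i≤n , Qix) Q1+nx → ℕ.<⇒≢ (s≤s i≤n) (Q-disjoint Qix Q1+nx) }))
  where
  split⁻¹ : ∀ x → (∃ λ i → i ≤ n × Q i x) ⊎ Q (suc n) x → ∃ λ i → i ≤ suc n × Q i x
  split⁻¹ x (inj₁ (i , i≤n , Qix)) = i , ℕ.m≤n⇒m≤1+n i≤n , Qix
  split⁻¹ x (inj₂ Q1+nx)          = suc n , ℕ.≤-refl , Q1+nx
  split : ∀ x → (∃ λ i → i ≤ suc n × Q i x) → (∃ λ i → i ≤ n × Q i x) ⊎ Q (suc n) x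
  split x (i , i≤1+n , Qix) with ℕ.m≤n⇒m<n∨m≡n i≤1+n
  ... | inj₁ (s≤s i≤n) = inj₁ (i , i≤n , Qix)
  ... | inj₂ refl      = inj₂ Qix

+≡⇔≤×∸≡ : ∀ {m k n} → m ℕ.+ k ≡ n ⇔ (m ≤ n × k ≡ n ∸ m)
+≡⇔≤×∸≡ {m} {k} = mk⇔ (λ { refl → ℕ.m≤m+n m k , sym (ℕ.m+n∸m≡n m k) })
                      (λ { (m≤n , refl) → ℕ.m+[n∸m]≡n m≤n })

length≤nodesL : ∀ ts → length ts ≤ nodesL ts
length≤nodesL []             = z≤n
length≤nodesL (node _ ∷ ts) = s≤s (ℕ.≤-trans (length≤nodesL ts) (ℕ.m≤n+m _ _))

module Forests (P : PTree → Set) (M : ℕ → ℕ)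
               (count-trees : ∀ n → Count (λ t → nodes t ≡ suc n × P t) (M n)) where

  Tree : ℕ → PTree → Set
  Tree m t = nodes t ≡ m × P t

  treeCount : ℕ → ℕ
  treeCount zero    = 0
  treeCount (suc n) = M n

  count-Tree : ∀ m → Count (Tree m) (treeCount m)
  count-Tree zero    = count-∅ (λ { (node _) (() , _) })
  count-Tree (suc n) = count-trees n

  gen≡treeCount : ∀ m → gen M m ≡ + treeCount m
  gen≡treeCount zero    = refl
  gen≡treeCount (suc m) = refl

  ConsOf : (ℕ → List PTree → Set) → ℕ → List PTree → Set
  ConsOf R n []       = ⊥
  ConsOf R n (t ∷ ts) = P t × nodes t ≤ n × R (n ∸ nodes t) ts

  count-ConsOf : ∀ {R : ℕ → List PTree → Set} {r : ℕ → ℕ} → (∀ m → Count (R m) (r m)) →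
                 ∀ n → Count (ConsOf R n) (sumToℕ n (λ i → treeCount i ℕ.* r (n ∸ i)))
  count-ConsOf {R} {r} count-R n =
    count-resp from-split to-split
      (count-⋃≤ Split (λ i → treeCount i ℕ.* r (n ∸ i)) n (λ {i} _ → count-product _∷_ List.∷-injective (count-Tree i) (count-R (n ∸ i)))
                (λ { (t , ts , (refl , _) , _ , refl) (_ , _ , (refl , _) , _ , refl) → refl }))
    where
    Split : ℕ → List PTree → Set
    Split i ts = ∃ λ t → ∃ λ ts′ → Tree i t × R (n ∸ i) ts′ × t ∷ ts′ ≡ ts
    from-split : ∀ ts → (∃ λ i → i ≤ n × Split i ts) → ConsOf R n ts
    from-split _ (_ , i≤n , t , ts , (refl , Pt) , Rts , refl) = Pt , i≤n , Rts
    to-split : ∀ ts → ConsOf R n ts → ∃ λ i → i ≤ n × Split i ts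
    to-split (t ∷ ts) (Pt , t≤n , Rts) = nodes t , t≤n , t , ts , (refl , Pt) , Rts , refl

  Forest : ℕ → List PTree → Set
  Forest n ts = nodesL ts ≡ n × All P ts

  ForestOfLength : ℕ → ℕ → List PTree → Set
  ForestOfLength d n ts = length ts ≡ d × Forest n ts

  forestCount : ℕ → ℕ → ℕ
  forestCount zero    zero    = 1
  forestCount zero    (suc n) = 0
  forestCount (suc d) n       = sumToℕ n (λ i → treeCount i ℕ.* forestCount d (n ∸ i))

  count-ForestOfLength-zero : ∀ n → Count (ForestOfLength 0 n) (forestCount 0 n)
  count-ForestOfLength-zero zero    = count-singleton [] (refl , refl , []) (λ { [] _ → refl ; (_ ∷ _) (() , _) })
  count-ForestOfLength-zero (suc n) = count-∅ (λ { [] (_ , () , _) ; (_ ∷ _) (() , _) })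

  Forest-∷ : ∀ {n t ts} → Forest n (t ∷ ts) ⇔ (P t × nodes t ≤ n × Forest (n ∸ nodes t) ts)
  Forest-∷ = mk⇔ (λ { (t+ts≡n , Pt ∷ Pts) → let (t≤n , ts≡n∸t) = to +≡⇔≤×∸≡ t+ts≡n in Pt , t≤n , ts≡n∸t , Pts })
                 (λ { (Pt , t≤n , ts≡n∸t , Pts) → from +≡⇔≤×∸≡ (t≤n , ts≡n∸t) , Pt ∷ Pts })

  count-ForestOfLength : ∀ d n → Count (ForestOfLength d n) (forestCount d n)
  count-ForestOfLength zero    n = count-ForestOfLength-zero n
  count-ForestOfLength (suc d) n = count-resp cons⇒forest forest⇒cons (count-ConsOf {r = forestCount d} (count-ForestOfLength d) n)
    where
    cons⇒forest : ∀ ts → ConsOf (ForestOfLength d) n ts → ForestOfLength (suc d) n ts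
    cons⇒forest (t ∷ ts) (Pt , t≤n , refl , Fts) = refl , from Forest-∷ (Pt , t≤n , Fts)
    forest⇒cons : ∀ ts → ForestOfLength (suc d) n ts → ConsOf (ForestOfLength d) n ts
    forest⇒cons (t ∷ ts) (refl , Ftts) = let (Pt , t≤n , Fts) = to Forest-∷ Ftts in Pt , t≤n , refl , Fts

  forestCount≡gen^^ : ∀ d n → + forestCount d n ≡ (gen M ^^ d) n
  forestCount≡gen^^ zero    zero    = refl
  forestCount≡gen^^ zero    (suc n) = refl
  forestCount≡gen^^ (suc d) n       = trans (+-sumToℕ n _) (sumTo-ext n λ i →
    trans (ℤ.pos-* (treeCount i) (forestCount d (n ∸ i)))
          (cong₂ _*_ (sym (gen≡treeCount i)) (forestCount≡gen^^ d (n ∸ i))))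

  count-Forest-by-length : ∀ {n} b → n ≤ b → Count (Forest n) (sumToℕ b (λ d → forestCount d n))
  count-Forest-by-length {n} b n≤b =
    count-resp (λ { ts (_ , _ , _ , Fts) → Fts })
               (λ { ts (ts≡n , Pts) → length ts , length≤b ts ts≡n , refl , ts≡n , Pts })
               (count-⋃≤ ForestOfLength-n _ b (λ {d} _ → count-ForestOfLength d n) (λ { (refl , _) (refl , _) → refl }))
    where
    ForestOfLength-n : ℕ → List PTree → Set
    ForestOfLength-n d = ForestOfLength d n
    length≤b : ∀ ts → nodesL ts ≡ n → length ts ≤ b
    length≤b ts refl = ℕ.≤-trans (length≤nodesL ts) n≤b

  count-Forest-by-first-tree : ∀ {F : ℕ → ℕ} → (∀ n → Count (Forest n) (F n)) →
    ∀ n → Count (Forest n) (forestCount 0 n ℕ.+ sumToℕ n (λ i → treeCount i ℕ.* F (n ∸ i)))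
  count-Forest-by-first-tree {F} count-F n =
    count-resp (λ { ts (inj₁ (_ , Fts)) → Fts ; (t ∷ ts) (inj₂ cons) → from Forest-∷ cons })
               (λ { [] Fts → inj₁ (refl , Fts) ; (t ∷ ts) Ftts → inj₂ (to Forest-∷ Ftts) })
               (count-⊎ (count-ForestOfLength-zero n) (count-ConsOf {r = F} count-F n)
                        (λ { [] _ () ; (_ ∷ _) (() , _) _ }))

  Forest-coefficients : ∀ {F : ℕ → ℕ} → (∀ n → Count (Forest n) (F n)) →
                        ∀ {n} b → n ≤ b → + F n ≡ sumTo b (λ d → (gen M ^^ d) n)
  Forest-coefficients {F} count-F {n} b n≤b = begin
    + F n                                    ≡⟨ cong +_ (count-unique (count-F n) (count-Forest-by-length b n≤b)) ⟩
    + sumToℕ b (λ d → forestCount d n)       ≡⟨ +-sumToℕ b _ ⟩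
    sumTo b (λ d → + forestCount d n)        ≡⟨ sumTo-ext b (λ d → forestCount≡gen^^ d n) ⟩
    sumTo b (λ d → (gen M ^^ d) n)           ∎
    where open ≡-Reasoning

  Forest-equation : ∀ {F : ℕ → ℕ} → (∀ n → Count (Forest n) (F n)) →
                    (λ n → + F n) ≋ oneS ⊕ gen M ⊛ (λ n → + F n)
  Forest-equation {F} count-F n = begin
    + F n
      ≡⟨ cong +_ (count-unique (count-F n) (count-Forest-by-first-tree count-F n)) ⟩
    + (forestCount 0 n ℕ.+ sumToℕ n (λ i → treeCount i ℕ.* F (n ∸ i)))
      ≡⟨ ℤ.pos-+ (forestCount 0 n) _ ⟩
    + forestCount 0 n + + sumToℕ n (λ i → treeCount i ℕ.* F (n ∸ i))
      ≡⟨ cong₂ _+_ (forestCount≡gen^^ 0 n) (+-sumToℕ n _) ⟩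
    oneS n + sumTo n (λ i → + (treeCount i ℕ.* F (n ∸ i)))
      ≡⟨ cong (_+_ (oneS n)) (sumTo-ext n (λ i → trans (ℤ.pos-* (treeCount i) (F (n ∸ i)))
                                                    (cong (_* + F (n ∸ i)) (sym (gen≡treeCount i))))) ⟩
    oneS n + (gen M ⊛ (λ n → + F n)) n
      ∎
    where open ≡-Reasoning

module BoundedTrees (k : ℕ) (M : ℕ → ℕ) (count-M : ∀ n → Count (PlaneBounded k n) (M n)) where

  open Forests (DegLe k) M count-M public

  count-PlaneBounded-by-root-degree : ∀ n → Count (PlaneBounded k n) (sumToℕ k (λ d → forestCount d n))
  count-PlaneBounded-by-root-degree n =
    count-resp (λ { _ (d , d≤k , ts , (refl , ts≡n , Pts) , refl) → cong suc ts≡n , node d≤k Pts })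
               (λ { (node ts) (ts≡n , node ts≤k Pts) → length ts , ts≤k , ts , (refl , ℕ.suc-injective ts≡n , Pts) , refl })
               (count-⋃≤ Root (λ d → forestCount d n) k
                         (λ {d} _ → count-image node node-injective (count-ForestOfLength d n))
                         (λ { (_ , (refl , _) , refl) (_ , (refl , _) , refl) → refl }))
    where
    Root : ℕ → PTree → Set
    Root d t = ∃ λ ts → ForestOfLength d n ts × node ts ≡ t
    node-injective : ∀ {ts us} → node ts ≡ node us → ts ≡ us
    node-injective refl = refl

  tree-equation : gen M ≋ zS ⊛ sumS (suc k) (gen M ^^_)
  tree-equation zero    = refl
  tree-equation (suc n) = begin
    + M n                                   ≡⟨ cong +_ (count-unique (count-M n) (count-PlaneBounded-by-root-degree n)) ⟩
    + sumToℕ k (λ d → forestCount d n)      ≡⟨ +-sumToℕ k _ ⟩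
    sumTo k (λ d → + forestCount d n)       ≡⟨ sumTo-ext k (λ d → forestCount≡gen^^ d n) ⟩
    sumTo k (λ d → (gen M ^^ d) n)          ≡⟨ sumS-suc-apply k (gen M ^^_) n ⟨
    sumS (suc k) (gen M ^^_) n              ≡⟨ zS⊛-suc (sumS (suc k) (gen M ^^_)) n ⟨
    (zS ⊛ sumS (suc k) (gen M ^^_)) (suc n) ∎
    where open ≡-Reasoning

  tree-equation-expanded : gen M ≋ zS ⊕ sumS k (λ i → zS ⊛ gen M ^^ suc i)
  tree-equation-expanded = ≋-trans tree-equation (≋-trans (⊛-sumS (suc k) zS (gen M ^^_))
    (≋-trans (sumS-suc-head k (λ i → zS ⊛ gen M ^^ i)) (⊕-cong (⊛-identityʳ zS) (≋-refl {sumS k (λ i → zS ⊛ gen M ^^ suc i)}))))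

  tree-geometric-equation : zS ⊖ zS ⊛ gen M ^^ suc k ≋ gen M ⊖ gen M ⊛ gen M
  tree-geometric-equation = begin
    zS ⊖ zS ⊛ gen M ^^ suc k               ≈⟨ ⊛-oneS⊖ zS (gen M ^^ suc k) ⟨
    zS ⊛ (oneS ⊖ gen M ^^ suc k)           ≈⟨ ⊛-congʳ zS (geometric-sum (suc k) (gen M)) ⟨
    zS ⊛ ((oneS ⊖ gen M) ⊛ G)              ≈⟨ swap zS (oneS ⊖ gen M) G ⟩
    (oneS ⊖ gen M) ⊛ (zS ⊛ G)              ≈⟨ ⊛-congʳ (oneS ⊖ gen M) tree-equation ⟨
    (oneS ⊖ gen M) ⊛ gen M                 ≈⟨ oneS⊖-⊛ (gen M) (gen M) ⟩
    gen M ⊖ gen M ⊛ gen M                  ∎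
    where
    open ≋-Reasoning
    G = sumS (suc k) (gen M ^^_)
    swap : ∀ a b c → a ⊛ (b ⊛ c) ≋ b ⊛ (a ⊛ c)
    swap = solve 3 (λ a b c → a :* (b :* c) := b :* (a :* c)) (λ _ → refl)

nodesL-++ : ∀ xs ys → nodesL (xs ++ ys) ≡ nodesL xs ℕ.+ nodesL ys
nodesL-++ []       ys = refl
nodesL-++ (x ∷ xs) ys = trans (cong (nodes x ℕ.+_) (nodesL-++ xs ys)) (sym (ℕ.+-assoc (nodes x) _ _))

take-++-≤ : ∀ {A : Set} r (xs ys : List A) → r ≤ length xs → take r (xs ++ ys) ≡ take r xs
take-++-≤ zero    xs       ys _         = refl
take-++-≤ (suc r) (x ∷ xs) ys (s≤s r≤) = cong (x ∷_) (take-++-≤ r xs ys r≤)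

drop-++-≤ : ∀ {A : Set} r (xs ys : List A) → r ≤ length xs → drop r (xs ++ ys) ≡ drop r xs ++ ys
drop-++-≤ zero    xs       ys _         = refl
drop-++-≤ (suc r) (x ∷ xs) ys (s≤s r≤) = drop-++-≤ r xs ys r≤

iter-++ : ∀ t xs ys → iter t (xs ++ ys) ≡ iter (iter t xs) ys
iter-++ t []       ys = refl
iter-++ t (x ∷ xs) ys = iter-++ (t ∧ x) xs ys

module Rotations (k : ℕ) where

  K : ℕ
  K = suc k

  -- Along the left spine, the forest of each right
  -- argument contributes its length mod K leading trees as the children of one new tree, and the
  -- rest as siblings; a k-rotation moves exactly K such right arguments, which leaves this unchanged.
  graft : List PTree → List PTree
  graft X = node (take (length X % K) X) ∷ drop (length X % K) X

  toForest : BTree → List PTree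
  toForest leaf    = []
  toForest (s ∧ t) = toForest s ++ graft (toForest t)

  graftAll : List BTree → List PTree
  graftAll []       = []
  graftAll (u ∷ us) = graft (toForest u) ++ graftAll us

  toForest-iter : ∀ t us → toForest (iter t us) ≡ toForest t ++ graftAll us
  toForest-iter t []       = sym (List.++-identityʳ (toForest t))
  toForest-iter t (u ∷ us) = trans (toForest-iter (t ∧ u) us) (List.++-assoc (toForest t) _ (graftAll us))

  graftAll-++ : ∀ us vs → graftAll (us ++ vs) ≡ graftAll us ++ graftAll vs
  graftAll-++ []       vs = refl
  graftAll-++ (u ∷ us) vs = trans (cong (graft (toForest u) ++_) (graftAll-++ us vs))
                                  (sym (List.++-assoc (graft (toForest u)) (graftAll us) (graftAll vs)))

  length-graft : ∀ X → length (graft X) ≡ suc (length X / K ℕ.* K)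
  length-graft X = cong suc (begin
    length (drop (length X % K) X)                       ≡⟨ List.length-drop (length X % K) X ⟩
    length X ∸ length X % K                              ≡⟨ cong (_∸ length X % K) (m≡m%n+[m/n]*n (length X) K) ⟩
    length X % K ℕ.+ length X / K ℕ.* K ∸ length X % K   ≡⟨ ℕ.m+n∸m≡n (length X % K) _ ⟩
    length X / K ℕ.* K                                   ∎)
    where open ≡-Reasoning

  length-graftAll : ∀ us → ∃ λ q → length (graftAll us) ≡ length us ℕ.+ q ℕ.* K
  length-graftAll []       = 0 , refl
  length-graftAll (u ∷ us) with length-graftAll us
  ... | q , |us|≡ = length (toForest u) / K ℕ.+ q , (begin
    length (graft (toForest u) ++ graftAll us)                 ≡⟨ List.length-++ (graft (toForest u)) ⟩
    length (graft (toForest u)) ℕ.+ length (graftAll us)       ≡⟨ cong₂ ℕ._+_ (length-graft (toForest u)) |us|≡ ⟩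
    suc (length (toForest u) / K ℕ.* K ℕ.+ (length us ℕ.+ q ℕ.* K))
                                                               ≡⟨ cong suc (regroup (length (toForest u) / K) (length us) q K) ⟩
    suc (length us ℕ.+ (length (toForest u) / K ℕ.+ q) ℕ.* K) ∎)
    where
    open ≡-Reasoning
    regroup : ∀ a l q K → a ℕ.* K ℕ.+ (l ℕ.+ q ℕ.* K) ≡ l ℕ.+ (a ℕ.+ q) ℕ.* K
    regroup = ℕ-Solver.solve-∀

  graft-++ : ∀ X Z → K ∣ length Z → graft (X ++ Z) ≡ graft X ++ Z
  graft-++ X Z (divides q |Z|≡) =
    cong₂ (λ ys zs → node ys ∷ zs)
          (trans (cong (λ r → take r (X ++ Z)) r≡) (take-++-≤ r X Z (m%n≤m (length X) K)))
          (trans (cong (λ r → drop r (X ++ Z)) r≡) (drop-++-≤ r X Z (m%n≤m (length X) K)))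
    where
    r = length X % K
    r≡ : length (X ++ Z) % K ≡ r
    r≡ = trans (cong (_% K) (trans (List.length-++ X) (cong (length X ℕ.+_) |Z|≡))) ([m+kn]%n≡m%n (length X) q K)

  toForest-Rot : ∀ {s t} → Rot K s t → toForest s ≡ toForest t
  toForest-Rot (here t₀ t₁ rest u |t₁∷rest|≡K) = begin
    toForest (iter t₀ (t₁ ∷ rest)) ++ graft (toForest u)     ≡⟨ cong (_++ graft (toForest u)) (toForest-iter t₀ (t₁ ∷ rest)) ⟩
    (toForest t₀ ++ graft (toForest t₁) ++ graftAll rest) ++ graft (toForest u)
                                                              ≡⟨ List.++-assoc (toForest t₀) _ _ ⟩
    toForest t₀ ++ (graft (toForest t₁) ++ graftAll rest) ++ graft (toForest u)
                                                              ≡⟨ cong (toForest t₀ ++_) (List.++-assoc (graft (toForest t₁)) (graftAll rest) _) ⟩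
    toForest t₀ ++ graft (toForest t₁) ++ graftAll rest ++ graft (toForest u)
                                                              ≡⟨ cong (λ w → toForest t₀ ++ graft (toForest t₁) ++ w) graftAll-Ys ⟨
    toForest t₀ ++ graft (toForest t₁) ++ graftAll Ys         ≡⟨ cong (toForest t₀ ++_) (graft-++ (toForest t₁) (graftAll Ys) K∣graftAll-Ys) ⟨
    toForest t₀ ++ graft (toForest t₁ ++ graftAll Ys)         ≡⟨ cong (λ w → toForest t₀ ++ graft w) (toForest-iter t₁ Ys) ⟨
    toForest t₀ ++ graft (toForest (iter t₁ Ys))              ∎
    where
    open ≡-Reasoning
    Ys = rest ++ [ u ]
    graftAll-Ys : graftAll Ys ≡ graftAll rest ++ graft (toForest u)
    graftAll-Ys = trans (graftAll-++ rest [ u ]) (cong (graftAll rest ++_) (List.++-identityʳ (graft (toForest u))))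
    K∣graftAll-Ys : K ∣ length (graftAll Ys)
    K∣graftAll-Ys with length-graftAll Ys
    ... | q , |Ys|≡ = divides (suc q) (trans |Ys|≡ (cong (ℕ._+ q ℕ.* K)
                        (trans (List.length-++ rest) (trans (ℕ.+-comm (length rest) 1) |t₁∷rest|≡K))))
  toForest-Rot (left t s→s′)  = cong (_++ graft (toForest t)) (toForest-Rot s→s′)
  toForest-Rot (right s t→t′) = cong (λ w → toForest s ++ graft w) (toForest-Rot t→t′)

  toForest-RotEq : ∀ {s t} → RotEq K s t → toForest s ≡ toForest t
  toForest-RotEq = gfold isEquivalence toForest toForest-Rot

  mutual
    fromTree : PTree → BTree
    fromTree (node ts) = fromForest leaf ts

    fromForest : BTree → List PTree → BTree
    fromForest a []       = a
    fromForest a (t ∷ ts) = fromForest (a ∧ fromTree t) ts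

  fromForest≡iter : ∀ a ts → fromForest a ts ≡ iter a (map fromTree ts)
  fromForest≡iter a []       = refl
  fromForest≡iter a (t ∷ ts) = fromForest≡iter (a ∧ fromTree t) ts

  fromForest-++ : ∀ a xs ys → fromForest a (xs ++ ys) ≡ fromForest (fromForest a xs) ys
  fromForest-++ a []       ys = refl
  fromForest-++ a (x ∷ xs) ys = fromForest-++ (a ∧ fromTree x) xs ys

  leaves-fromForest : ∀ a ts → leaves (fromForest a ts) ≡ leaves a ℕ.+ nodesL ts
  leaves-fromForest a []              = sym (ℕ.+-identityʳ (leaves a))
  leaves-fromForest a (node xs ∷ ts) = begin
    leaves (fromForest (a ∧ fromForest leaf xs) ts)         ≡⟨ leaves-fromForest (a ∧ fromForest leaf xs) ts ⟩
    leaves a ℕ.+ leaves (fromForest leaf xs) ℕ.+ nodesL ts  ≡⟨ cong (λ w → leaves a ℕ.+ w ℕ.+ nodesL ts) (leaves-fromForest leaf xs) ⟩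
    leaves a ℕ.+ suc (nodesL xs) ℕ.+ nodesL ts              ≡⟨ ℕ.+-assoc (leaves a) (suc (nodesL xs)) (nodesL ts) ⟩
    leaves a ℕ.+ nodesL (node xs ∷ ts)                       ∎
    where open ≡-Reasoning

  graft-short : ∀ xs → length xs ≤ k → graft xs ≡ [ node xs ]
  graft-short xs |xs|≤k rewrite m<n⇒m%n≡m {n = K} (s≤s |xs|≤k) =
    cong₂ (λ ys zs → node ys ∷ zs) (List.take-all (length xs) xs ℕ.≤-refl) (List.drop-all (length xs) xs ℕ.≤-refl)

  toForest-fromForest : ∀ a ts → All (DegLe k) ts → toForest (fromForest a ts) ≡ toForest a ++ ts
  toForest-fromForest a []              []                         = sym (List.++-identityʳ (toForest a))
  toForest-fromForest a (node xs ∷ ts) (node |xs|≤k xs-ok ∷ ts-ok) = begin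
    toForest (fromForest (a ∧ fromForest leaf xs) ts)            ≡⟨ toForest-fromForest (a ∧ fromForest leaf xs) ts ts-ok ⟩
    (toForest a ++ graft (toForest (fromForest leaf xs))) ++ ts  ≡⟨ cong (λ w → (toForest a ++ graft w) ++ ts) (toForest-fromForest leaf xs xs-ok) ⟩
    (toForest a ++ graft xs) ++ ts                               ≡⟨ cong (λ w → (toForest a ++ w) ++ ts) (graft-short xs |xs|≤k) ⟩
    (toForest a ++ [ node xs ]) ++ ts                            ≡⟨ List.++-assoc (toForest a) [ node xs ] ts ⟩
    toForest a ++ node xs ∷ ts                                   ∎
    where open ≡-Reasoning

  graft-DegLe : ∀ X → All (DegLe k) X → All (DegLe k) (graft X)
  graft-DegLe X X-ok = node |take|≤k (All.take⁺ r X-ok) ∷ All.drop⁺ r X-ok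
    where
    r = length X % K
    |take|≤k : length (take r X) ≤ k
    |take|≤k = ℕ.≤-trans (ℕ.≤-reflexive (List.length-take r X))
                         (ℕ.≤-trans (ℕ.m⊓n≤m r (length X)) (ℕ.≤-pred (m%n<n (length X) K)))

  toForest-DegLe : ∀ t → All (DegLe k) (toForest t)
  toForest-DegLe leaf    = []
  toForest-DegLe (s ∧ t) = All.++⁺ (toForest-DegLe s) (graft-DegLe (toForest t) (toForest-DegLe t))

  nodesL-graft : ∀ X → nodesL (graft X) ≡ suc (nodesL X)
  nodesL-graft X = cong suc (trans (sym (nodesL-++ (take r X) (drop r X))) (cong nodesL (List.take++drop≡id r X)))
    where r = length X % K

  leaves-toForest : ∀ t → leaves t ≡ suc (nodesL (toForest t))
  leaves-toForest leaf    = refl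
  leaves-toForest (s ∧ t) = begin
    leaves s ℕ.+ leaves t                                    ≡⟨ cong₂ ℕ._+_ (leaves-toForest s) (leaves-toForest t) ⟩
    suc (nodesL (toForest s)) ℕ.+ suc (nodesL (toForest t))  ≡⟨ cong (λ w → suc (nodesL (toForest s) ℕ.+ w)) (nodesL-graft (toForest t)) ⟨
    suc (nodesL (toForest s) ℕ.+ nodesL (graft (toForest t))) ≡⟨ cong suc (nodesL-++ (toForest s) (graft (toForest t))) ⟨
    suc (nodesL (toForest (s ∧ t)))                          ∎
    where open ≡-Reasoning

  ∧-congˡ : ∀ {a b} c → RotEq K a b → RotEq K (a ∧ c) (b ∧ c)
  ∧-congˡ c = gmap (_∧ c) (left c)

  ∧-congʳ : ∀ c {a b} → RotEq K a b → RotEq K (c ∧ a) (c ∧ b)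
  ∧-congʳ c = gmap (c ∧_) (right c)

  iter-congˡ : ∀ ys {a b} → RotEq K a b → RotEq K (iter a ys) (iter b ys)
  iter-congˡ []       a~b = a~b
  iter-congˡ (y ∷ ys) a~b = iter-congˡ ys (∧-congˡ y a~b)

  rotate-block : ∀ a c ys → length ys ≡ K → RotEq K (a ∧ iter c ys) (iter (a ∧ c) ys)
  rotate-block a c ys |ys|≡K with initLast ys
  rotate-block a c _ () | []
  rotate-block a c _ |ys|≡K | rest ∷ʳ′ u = begin
    a ∧ iter c (rest ++ [ u ])   ≈⟨ symmetric (Rot K) (return (here a c rest u |c∷rest|≡K)) ⟩
    iter (a ∧ c) rest ∧ u        ≡⟨ iter-++ (a ∧ c) rest [ u ] ⟨
    iter (a ∧ c) (rest ++ [ u ]) ∎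
    where
    open Relation.Binary.Reasoning.Setoid (EqClosure.setoid (Rot K))
    |c∷rest|≡K : length (c ∷ rest) ≡ K
    |c∷rest|≡K = trans (ℕ.+-comm 1 (length rest)) (trans (sym (List.length-++ rest)) |ys|≡K)

  rotate-blocks : ∀ q a c ys → length ys ≡ q ℕ.* K → RotEq K (a ∧ iter c ys) (iter (a ∧ c) ys)
  rotate-blocks zero    a c []      _      = EqClosure.reflexive (Rot K)
  rotate-blocks (suc q) a c ys |ys|≡ = begin
    a ∧ iter c ys               ≡⟨ cong (λ w → a ∧ iter c w) (List.take++drop≡id K ys) ⟨
    a ∧ iter c (ys₁ ++ ys₂)     ≡⟨ cong (a ∧_) (iter-++ c ys₁ ys₂) ⟩
    a ∧ iter (iter c ys₁) ys₂   ≈⟨ rotate-blocks q a (iter c ys₁) ys₂ |ys₂|≡ ⟩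
    iter (a ∧ iter c ys₁) ys₂   ≈⟨ iter-congˡ ys₂ (rotate-block a c ys₁ |ys₁|≡K) ⟩
    iter (iter (a ∧ c) ys₁) ys₂ ≡⟨ iter-++ (a ∧ c) ys₁ ys₂ ⟨
    iter (a ∧ c) (ys₁ ++ ys₂)   ≡⟨ cong (iter (a ∧ c)) (List.take++drop≡id K ys) ⟩
    iter (a ∧ c) ys             ∎
    where
    open Relation.Binary.Reasoning.Setoid (EqClosure.setoid (Rot K))
    ys₁ = take K ys
    ys₂ = drop K ys
    |ys₁|≡K : length ys₁ ≡ K
    |ys₁|≡K = trans (List.length-take K ys) (trans (cong (K ℕ.⊓_) |ys|≡) (ℕ.m≤n⇒m⊓n≡m (ℕ.m≤m+n K (q ℕ.* K))))
    |ys₂|≡ : length ys₂ ≡ q ℕ.* K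
    |ys₂|≡ = trans (List.length-drop K ys) (trans (cong (_∸ K) |ys|≡) (ℕ.m+n∸m≡n K (q ℕ.* K)))

  RotEq-normalForm : ∀ t → RotEq K t (fromForest leaf (toForest t))
  RotEq-normalForm leaf    = EqClosure.reflexive (Rot K)
  RotEq-normalForm (s ∧ u) = begin
    s ∧ u                                        ≈⟨ ∧-congˡ u (RotEq-normalForm s) ⟩
    a ∧ u                                        ≈⟨ ∧-congʳ a (RotEq-normalForm u) ⟩
    a ∧ fromForest leaf X                        ≡⟨ cong (λ w → a ∧ fromForest leaf w) (List.take++drop≡id r X) ⟨
    a ∧ fromForest leaf (take r X ++ drop r X)   ≡⟨ cong (a ∧_) (fromForest-++ leaf (take r X) (drop r X)) ⟩
    a ∧ fromForest c (drop r X)                  ≡⟨ cong (a ∧_) (fromForest≡iter c (drop r X)) ⟩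
    a ∧ iter c (map fromTree (drop r X))         ≈⟨ rotate-blocks (length X / K) a c (map fromTree (drop r X)) |ys|≡ ⟩
    iter (a ∧ c) (map fromTree (drop r X))       ≡⟨ fromForest≡iter (a ∧ c) (drop r X) ⟨
    fromForest (a ∧ c) (drop r X)                ≡⟨ fromForest-++ leaf (toForest s) (graft X) ⟨
    fromForest leaf (toForest (s ∧ u))           ∎
    where
    open Relation.Binary.Reasoning.Setoid (EqClosure.setoid (Rot K))
    X = toForest u
    r = length X % K
    a = fromForest leaf (toForest s)
    c = fromForest leaf (take r X)
    |ys|≡ : length (map fromTree (drop r X)) ≡ length X / K ℕ.* K
    |ys|≡ = trans (List.length-map fromTree (drop r X)) (ℕ.suc-injective (length-graft X))

  toForest≡⇒RotEq : ∀ {a b} → toForest a ≡ toForest b → RotEq K a b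
  toForest≡⇒RotEq {a} {b} a≡b = begin
    a                           ≈⟨ RotEq-normalForm a ⟩
    fromForest leaf (toForest a) ≡⟨ cong (fromForest leaf) a≡b ⟩
    fromForest leaf (toForest b) ≈⟨ RotEq-normalForm b ⟨
    b                           ∎
    where open Relation.Binary.Reasoning.Setoid (EqClosure.setoid (Rot K))

  count-classes : ∀ {n c} → ClassCount (RotEq K) (BinLeaves n) c →
                  Count (λ ts → nodesL ts ≡ n × All (DegLe k) ts) c
  count-classes {n} (reps , |reps| , reps-ok , reps-distinct , reps-cover) =
    map toForest reps ,
    trans (List.length-map toForest reps) |reps| ,
    AllPairs.map⁺ (AllPairs.map (λ ¬a~b → ¬a~b ∘ toForest≡⇒RotEq) reps-distinct) ,
    λ ts → mk⇔ (represented ts) (representative ts)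
    where
    represented : ∀ ts → ts ∈ map toForest reps → nodesL ts ≡ n × All (DegLe k) ts
    represented ts ts∈ with ∈-map⁻ toForest ts∈
    ... | a , a∈reps , refl =
      ℕ.suc-injective (trans (sym (leaves-toForest a)) (All.lookup reps-ok a∈reps)) , toForest-DegLe a
    representative : ∀ ts → nodesL ts ≡ n × All (DegLe k) ts → ts ∈ map toForest reps
    representative ts (ts≡n , ts-ok) =
      Any.map⁺ (Any.map (λ t~a → trans (sym (toForest-fromForest leaf ts ts-ok)) (toForest-RotEq t~a))
                        (reps-cover (fromForest leaf ts) (trans (leaves-fromForest leaf ts) (cong suc ts≡n))))

module ModularCatalan (k : ℕ) (C M : ℕ → ℕ)
                      (count-C : ∀ n → ClassCount (RotEq (suc k)) (BinLeaves n) (C n))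
                      (count-M : ∀ n → Count (PlaneBounded k n) (M n)) where

  open BoundedTrees k M count-M public

  count-C-Forest : ∀ n → Count (Forest n) (C n)
  count-C-Forest n = Rotations.count-classes k (count-C n)

  catalan-series : gen C ≋ zS ⊕ infSum (λ j → zS ⊛ gen M ^^ suc j)
  catalan-series zero    = refl
  catalan-series (suc n) = begin
    + C n                                                      ≡⟨ Forest-coefficients count-C-Forest (2 ℕ.+ n) (ℕ.m≤n+m n 2) ⟩
    sumTo (2 ℕ.+ n) (λ d → (gen M ^^ d) n)                     ≡⟨ sumTo-suc-head (suc n) (λ d → (gen M ^^ d) n) ⟩
    oneS n + sumTo (suc n) (λ j → (gen M ^^ suc j) n)          ≡⟨ cong₂ _+_ (sym (shift-zS n)) (sumTo-ext (suc n) (λ j → sym (zS⊛-suc (gen M ^^ suc j) n))) ⟩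
    zS (suc n) + sumTo (suc n) (λ j → (zS ⊛ gen M ^^ suc j) (suc n)) ∎
    where open ≡-Reasoning

  catalan-inverse : gen C ⊛ (oneS ⊖ gen M) ≋ zS
  catalan-inverse = begin
    gen C ⊛ (oneS ⊖ gen M)          ≈⟨ ⊛-congˡ (oneS ⊖ gen M) C≋zF ⟩
    (zS ⊛ F) ⊛ (oneS ⊖ gen M)       ≈⟨ rotate zS F (oneS ⊖ gen M) ⟩
    zS ⊛ ((oneS ⊖ gen M) ⊛ F)       ≈⟨ ⊛-congʳ zS (oneS⊖-⊛ (gen M) F) ⟩
    zS ⊛ (F ⊖ gen M ⊛ F)            ≈⟨ ⊛-congʳ zS F-MF≋1 ⟩
    zS ⊛ oneS                       ≈⟨ ⊛-identityʳ zS ⟩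
    zS                              ∎
    where
    open ≋-Reasoning
    F : Series
    F n = + C n
    C≋zF : gen C ≋ zS ⊛ F
    C≋zF zero    = refl
    C≋zF (suc n) = sym (zS⊛-suc F n)
    F-MF≋1 : F ⊖ gen M ⊛ F ≋ oneS
    F-MF≋1 n = trans (cong (λ f → f + - (gen M ⊛ F) n) (Forest-equation count-C-Forest n))
                     (cancel (oneS n) ((gen M ⊛ F) n))
      where
      cancel : ∀ a b → a + b + - b ≡ a
      cancel = solve-∀
    rotate : ∀ a b c → (a ⊛ b) ⊛ c ≋ a ⊛ (c ⊛ b)
    rotate = solve 3 (λ a b c → (a :* b) :* c := a :* (c :* b)) (λ _ → refl)

catalan-equation-k≥2 : ∀ k (C M : ℕ → ℕ) →
  (∀ n → ClassCount (RotEq (suc k)) (BinLeaves n) (C n)) → (∀ n → Count (PlaneBounded k n) (M n)) →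
  2 ≤ suc k → (gen C ⊖ zS) ^^ suc k ⊖ gen C ^^ suc k ⊕ gen C ^^ k ⊖ zS ⊛ gen C ^^ (k ∸ 1) ≋ zeroS
catalan-equation-k≥2 zero    C M count-C count-M (s≤s ())
catalan-equation-k≥2 (suc m) C M count-C count-M _ =
  algebraic-equation m {gen C} {gen M} {zS} (≋-trans (≋-sym (⊛-oneS⊖ (gen C) (gen M))) catalan-inverse) tree-geometric-equation zS⊛-cancel
  where open ModularCatalan (suc m) C M count-C count-M

catalan-equation-k≡1 : ∀ k (C M : ℕ → ℕ) →
  (∀ n → ClassCount (RotEq (suc k)) (BinLeaves n) (C n)) → (∀ n → Count (PlaneBounded k n) (M n)) →
  suc k ≡ 1 → gen C ⊛ ((gen C ⊖ zS) ⊖ gen C ⊕ oneS) ⊖ zS ≋ zeroS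
catalan-equation-k≡1 (suc _) C M count-C count-M ()
catalan-equation-k≡1 zero    C M count-C count-M refl = ≋⇒⊖≋zeroS (begin
  gen C ⊛ ((gen C ⊖ zS) ⊖ gen C ⊕ oneS) ≈⟨ ⊛-congʳ (gen C) (λ n → cancel (gen C n) (zS n) (oneS n)) ⟩
  gen C ⊛ (oneS ⊖ zS)                   ≈⟨ ⊛-congʳ (gen C) (⊕-cong (≋-refl {oneS}) (λ n → cong -_ (M≋z n))) ⟨
  gen C ⊛ (oneS ⊖ gen M)                ≈⟨ catalan-inverse ⟩
  zS                                    ∎)
  where
  open ModularCatalan 0 C M count-C count-M
  open ≋-Reasoning
  M≋z : gen M ≋ zS
  M≋z n = trans (tree-equation-expanded n) (ℤ.+-identityʳ (zS n))
  cancel : ∀ x z o → x + - z + - x + o ≡ o + - z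
  cancel = solve-∀

modular-catalan-equations : (k : ℕ) → 1 ≤ k → (C M : ℕ → ℕ) →
  (∀ n → ClassCount (RotEq k) (BinLeaves n) (C n)) →
  (∀ n → Count (PlaneBounded (k ∸ 1) n) (M n)) →
  (gen C ≋ zS ⊕ infSum (λ j → zS ⊛ gen M ^^ suc j))
  × (gen C ⊛ (oneS ⊖ gen M) ≋ zS)
  × (2 ≤ k → (gen C ⊖ zS) ^^ k ⊖ gen C ^^ k ⊕ gen C ^^ (k ∸ 1) ⊖ zS ⊛ gen C ^^ (k ∸ 2) ≋ zeroS)
  × (k ≡ 1 → gen C ⊛ ((gen C ⊖ zS) ⊖ gen C ⊕ oneS) ⊖ zS ≋ zeroS)
modular-catalan-equations (suc k) _ C M count-C count-M =
  catalan-series , catalan-inverse , catalan-equation-k≥2 k C M count-C count-M , catalan-equation-k≡1 k C M count-C count-M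
  where open ModularCatalan k C M count-C count-M

proposition4p6 :
    ((k : ℕ) (M : ℕ → ℕ) → (∀ n → Count (PlaneBounded k n) (M n)) →
      gen M ≋ zS ⊕ sumS k (λ i → zS ⊛ gen M ^^ suc i))
    ×
    ((k : ℕ) → 1 ≤ k → (C M : ℕ → ℕ) →
      (∀ n → ClassCount (RotEq k) (BinLeaves n) (C n)) →
      (∀ n → Count (PlaneBounded (k ∸ 1) n) (M n)) →
      (gen C ≋ zS ⊕ infSum (λ j → zS ⊛ gen M ^^ suc j))
      × (gen C ⊛ (oneS ⊖ gen M) ≋ zS)
      × (2 ≤ k →
          (gen C ⊖ zS) ^^ k ⊖ gen C ^^ k ⊕ gen C ^^ (k ∸ 1) ⊖ zS ⊛ gen C ^^ (k ∸ 2) ≋ zeroS)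
      × (k ≡ 1 →
          gen C ⊛ ((gen C ⊖ zS) ⊖ gen C ⊕ oneS) ⊖ zS ≋ zeroS))
proposition4p6 = BoundedTrees.tree-equation-expanded , modular-catalan-equations
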